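{- Let $m \geq 3$ and $1 \leq i \leq m-2$ be integers, and let $A_1, A_2, \ldots, A_{i+1}$ be nonnegative integers. If $$\sum_{j=1}^{i+1}\binom{m-j}{i-j+1}A_j \leq (i+1)\binom{m}{i+1},$$ then $$\sum_{j=1}^{i}\binom{m-j}{i-j}A_j \leq i\binom{m}{i}.$$
   Context: In the paper, $A_j$ is the number of members of cardinality $j$ in a finite collection (multiset) of subsets of an $m$-element set; any tuple of nonnegative integers arises this way. -}

module Defs where

open import Data.Nat using (ℕ; zero; suc; _+_)

sum1to : ℕ → (ℕ → ℕ) → ℕ
sum1to zero    f = 0
sum1to (suc n) f = sum1to n f + f (suc n)

-- Weight the j-th term of the desired sum by m − i. With n = m − j and k = i − j, the
-- absorption identity (n − k)·C(n,k) = (k+1)·C(n,k+1) turns (m − i)·C(m−j, i−j) into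
-- (i − j + 1)·C(m−j, i−j+1) ≤ i·C(m−j, i+1−j), which is i times the j-th coefficient of the
-- hypothesis. Summing, (m − i)·Σ ≤ i·(i+1)·C(m,i+1) = i·(m − i)·C(m,i), and m − i > 0 cancels.
module Submission where

open import Defs
open import Data.Nat using (ℕ; zero; suc; _+_; _*_; _∸_; _≤_; _<_; z≤n; s≤s; >-nonZero)
open import Data.Nat.Combinatorics using (_C_; nC1≡n; nCk+nC[k+1]≡[n+1]C[k+1])
open import Data.Nat.Properties
open import Data.Nat.Solver using (module +-*-Solver)
open import Algebra.Properties.CommutativeSemigroup *-commutativeSemigroup using (x∙yz≈y∙xz)
open import Relation.Binary.PropositionalEquality

open +-*-Solver

[1+k]*nC[1+k]+k*nCk≡n*nCk : ∀ n k → suc k * (n C suc k) + k * (n C k) ≡ n * (n C k)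
[1+k]*nC[1+k]+k*nCk≡n*nCk zero    zero    = refl
[1+k]*nC[1+k]+k*nCk≡n*nCk zero    (suc k) = cong₂ _+_ (*-zeroʳ (suc (suc k))) (*-zeroʳ (suc k))
[1+k]*nC[1+k]+k*nCk≡n*nCk (suc n) zero    =
  trans (+-identityʳ _) (trans (*-identityˡ _) (trans (nC1≡n (suc n)) (sym (*-identityʳ _))))
[1+k]*nC[1+k]+k*nCk≡n*nCk (suc n) (suc k) = begin
  suc (suc k) * (suc n C suc (suc k)) + suc k * (suc n C suc k)
    ≡⟨ cong₂ (λ x y → suc (suc k) * x + suc k * y)
             (sym (nCk+nC[k+1]≡[n+1]C[k+1] n (suc k))) (sym (nCk+nC[k+1]≡[n+1]C[k+1] n k)) ⟩
  suc (suc k) * (b + c) + suc k * (a + b)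
    ≡⟨ solve 4 (λ K A B Cc → (con 2 :+ K) :* (B :+ Cc) :+ (con 1 :+ K) :* (A :+ B)
                 := ((con 2 :+ K) :* Cc :+ (con 1 :+ K) :* B) :+ B :+ A :+ ((con 1 :+ K) :* B :+ K :* A))
               refl k a b c ⟩
  (suc (suc k) * c + suc k * b) + b + a + (suc k * b + k * a)
    ≡⟨ cong₂ (λ x y → x + b + a + y)
             ([1+k]*nC[1+k]+k*nCk≡n*nCk n (suc k)) ([1+k]*nC[1+k]+k*nCk≡n*nCk n k) ⟩
  n * b + b + a + n * a
    ≡⟨ solve 3 (λ N A B → N :* B :+ B :+ A :+ N :* A := (con 1 :+ N) :* (A :+ B)) refl n a b ⟩
  suc n * (a + b)
    ≡⟨ cong (suc n *_) (nCk+nC[k+1]≡[n+1]C[k+1] n k) ⟩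
  suc n * (suc n C suc k)
    ∎
  where
  open ≡-Reasoning
  a = n C k
  b = n C suc k
  c = n C suc (suc k)

[1+k]*nC[1+k]≡[n∸k]*nCk : ∀ n k → suc k * (n C suc k) ≡ (n ∸ k) * (n C k)
[1+k]*nC[1+k]≡[n∸k]*nCk n k = begin
  suc k * (n C suc k)                         ≡⟨ m+n∸n≡m _ (k * (n C k)) ⟨
  suc k * (n C suc k) + k * (n C k) ∸ k * (n C k) ≡⟨ cong (_∸ k * (n C k)) ([1+k]*nC[1+k]+k*nCk≡n*nCk n k) ⟩
  n * (n C k) ∸ k * (n C k)                   ≡⟨ *-distribʳ-∸ (n C k) n k ⟨
  (n ∸ k) * (n C k)                           ∎
  where open ≡-Reasoning

sum1to-mono-≤ : ∀ n {f g : ℕ → ℕ} → (∀ j → 1 ≤ j → j ≤ n → f j ≤ g j) → sum1to n f ≤ sum1to n g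
sum1to-mono-≤ zero    f≤g = z≤n
sum1to-mono-≤ (suc n) f≤g =
  +-mono-≤ (sum1to-mono-≤ n (λ j 1≤j j≤n → f≤g j 1≤j (m≤n⇒m≤1+n j≤n))) (f≤g (suc n) (s≤s z≤n) ≤-refl)

sum1to-*-distribˡ : ∀ n c (f : ℕ → ℕ) → sum1to n (λ j → c * f j) ≡ c * sum1to n f
sum1to-*-distribˡ zero    c f = sym (*-zeroʳ c)
sum1to-*-distribˡ (suc n) c f =
  trans (cong (_+ c * f (suc n)) (sum1to-*-distribˡ n c f)) (sym (*-distribˡ-+ c (sum1to n f) (f (suc n))))

[m∸i]*[m∸j]C[i∸j]≤i*[m∸j]C[1+i∸j] : ∀ {m i j} → 1 ≤ j → j ≤ i → i ≤ m →
  (m ∸ i) * ((m ∸ j) C (i ∸ j)) ≤ i * ((m ∸ j) C (suc i ∸ j))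
[m∸i]*[m∸j]C[i∸j]≤i*[m∸j]C[1+i∸j] {m} {i} {j} 1≤j j≤i i≤m = begin
  (m ∸ i) * ((m ∸ j) C (i ∸ j))                   ≡⟨ cong (_* ((m ∸ j) C (i ∸ j))) m∸i≡[m∸j]∸[i∸j] ⟩
  ((m ∸ j) ∸ (i ∸ j)) * ((m ∸ j) C (i ∸ j))       ≡⟨ [1+k]*nC[1+k]≡[n∸k]*nCk (m ∸ j) (i ∸ j) ⟨
  suc (i ∸ j) * ((m ∸ j) C suc (i ∸ j))           ≡⟨ cong (λ k → suc (i ∸ j) * ((m ∸ j) C k)) (+-∸-assoc 1 j≤i) ⟨
  suc (i ∸ j) * ((m ∸ j) C (suc i ∸ j))           ≤⟨ *-monoˡ-≤ _ (∸-monoʳ-< 1≤j j≤i) ⟩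
  i * ((m ∸ j) C (suc i ∸ j))                     ∎
  where
  open ≤-Reasoning
  m∸i≡[m∸j]∸[i∸j] : m ∸ i ≡ (m ∸ j) ∸ (i ∸ j)
  m∸i≡[m∸j]∸[i∸j] = sym (trans (∸-+-assoc m j (i ∸ j)) (cong (m ∸_) (m+[n∸m]≡n j≤i)))

shifted-binomial-sum-bound : ∀ m i → i < m → (A : ℕ → ℕ)
  → sum1to (suc i) (λ j → ((m ∸ j) C (suc i ∸ j)) * A j) ≤ suc i * (m C suc i)
  → sum1to i (λ j → ((m ∸ j) C (i ∸ j)) * A j) ≤ i * (m C i)
shifted-binomial-sum-bound m i i<m A hyp = *-cancelˡ-≤ (m ∸ i) {{>-nonZero (m<n⇒0<n∸m i<m)}} (begin
  (m ∸ i) * sum1to i f          ≡⟨ sum1to-*-distribˡ i (m ∸ i) f ⟨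
  sum1to i (λ j → (m ∸ i) * f j) ≤⟨ sum1to-mono-≤ i weighted-term-bound ⟩
  sum1to i (λ j → i * g j)      ≡⟨ sum1to-*-distribˡ i i g ⟩
  i * sum1to i g                ≤⟨ *-monoʳ-≤ i (≤-trans (m≤m+n (sum1to i g) (g (suc i))) hyp) ⟩
  i * (suc i * (m C suc i))     ≡⟨ cong (i *_) ([1+k]*nC[1+k]≡[n∸k]*nCk m i) ⟩
  i * ((m ∸ i) * (m C i))       ≡⟨ x∙yz≈y∙xz i (m ∸ i) (m C i) ⟩
  (m ∸ i) * (i * (m C i))       ∎)
  where
  open ≤-Reasoning
  f g : ℕ → ℕ
  f j = ((m ∸ j) C (i ∸ j)) * A j
  g j = ((m ∸ j) C (suc i ∸ j)) * A j
  weighted-term-bound : ∀ j → 1 ≤ j → j ≤ i → (m ∸ i) * f j ≤ i * g j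
  weighted-term-bound j 1≤j j≤i = begin
    (m ∸ i) * f j                                  ≡⟨ *-assoc (m ∸ i) _ (A j) ⟨
    (m ∸ i) * ((m ∸ j) C (i ∸ j)) * A j            ≤⟨ *-monoˡ-≤ (A j) ([m∸i]*[m∸j]C[i∸j]≤i*[m∸j]C[1+i∸j] 1≤j j≤i (<⇒≤ i<m)) ⟩
    i * ((m ∸ j) C (suc i ∸ j)) * A j              ≡⟨ *-assoc i _ (A j) ⟩
    i * g j                                        ∎

lemma2p1 : (m i : ℕ) → 3 ≤ m → 1 ≤ i → i ≤ m ∸ 2 → (A : ℕ → ℕ)
    → sum1to (i + 1) (λ j → ((m ∸ j) C ((i + 1) ∸ j)) * A j) ≤ (i + 1) * (m C (i + 1))
    → sum1to i (λ j → ((m ∸ j) C (i ∸ j)) * A j) ≤ i * (m C i)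
lemma2p1 m i 3≤m _ i≤m∸2 A hyp = shifted-binomial-sum-bound m i i<m A
  (subst (λ k → sum1to k (λ j → ((m ∸ j) C (k ∸ j)) * A j) ≤ k * (m C k)) (+-comm i 1) hyp)
  where
  i<m : i < m
  i<m = ≤-<-trans i≤m∸2 (∸-monoʳ-< {o = 0} (s≤s z≤n) (≤-trans (s≤s (s≤s z≤n)) 3≤m))
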